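{- Let $k\in\omega$ and let $s\le k-2$ be an integer. Then every $\Sigma_0$-set $\tau\subset\mathbf 2^{k+1}$ is contained in some shift $x+\Xi^k_s$, $x\in\mathbb{Z}^{k+1}$, of the sandwich $\Xi^k_s$.
   Context: $\mathbf 2=\{0,1\}$; points of $\mathbb{R}^{k+1}$ are written $(x_i)_{i=0}^k$ and $\mathrm{pr}_i$ is the $i$-th coordinate projection. A facet of the cube $\mathbf 2^{k+1}$ is a set $\mathbf 2^{k+1}\cap\mathrm{pr}_i^{ -1}(l)$ with $i\in\{0,\dots,k\}$, $l\in\{0,1\}$. Let $\Sigma_0:\mathbb{R}^{k+1}\to\mathbb{R}^2$, $\Sigma_0((x_i)_{i=0}^k)=(x_0,\sum_{i=1}^kx_i)$. A subset $\tau\subset\mathbf 2^{k+1}$ is a $\Sigma_0$-set if $\tau$ lies in a facet of $\mathbf 2^{k+1}$ and there is $a\in\{0,\dots,k-1\}$ with $\Sigma_0(\tau)\subset\{(0,a),(0,a+1),(1,a+1)\}$ or $\Sigma_0(\tau)\subset\{(0,a),(1,a),(1,a+1)\}$. For real $s$, $\mathbf 2^k_{<s}=\{(x_i)_{i=1}^k\in\mathbf 2^k:\sum x_i<s\}$, $\mathbf 2^k_{>s}=\{(x_i)_{i=1}^k\in\mathbf 2^k:\sum x_i>s\}$, and $\Xi^k_s=(\{ -1\}\times\mathbf 2^k_{<s})\cup(\{0\}\times\mathbf 2^k_{<k})\cup(\{1\}\times\mathbf 2^k_{>s})\subset\mathbb{Z}\times\mathbb{Z}^k=\mathbb{Z}^{k+1}$,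 the first factor being coordinate $0$. -}

module Defs where

open import Data.Nat using (ℕ; zero; suc)
open import Data.Integer using (ℤ; +_; -_; _+_; _-_; _<_; _>_; _≤_)
open import Data.Fin using (Fin; zero; suc)
open import Data.Product using (_×_; Σ; ∃; ∃-syntax; _,_)
open import Data.Sum using (_⊎_)
open import Relation.Binary.PropositionalEquality using (_≡_)
open import Level using (0ℓ)
open import Relation.Unary using (Pred; _⊆_)

Pt : ℕ → Set
Pt n = Fin n → ℤ

sumℤ : ∀ {n} → Pt n → ℤ
sumℤ {zero}  x = + 0
sumℤ {suc n} x = x zero + sumℤ (λ i → x (suc i))

tail : ∀ {k} → Pt (suc k) → Pt k
tail x i = x (suc i)

InCube : ∀ {n} → Pt n → Set
InCube x = ∀ i → (x i ≡ + 0) ⊎ (x i ≡ + 1)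

Σ₀ : ∀ {k} → Pt (suc k) → ℤ × ℤ
Σ₀ x = x zero , sumℤ (tail x)

InFacet : ∀ {k} → Pred (Pt (suc k)) 0ℓ → Set
InFacet {k} τ = ∃[ i ] ∃[ l ] (((l ≡ + 0) ⊎ (l ≡ + 1)) × (∀ {y} → τ y → y i ≡ l))

IsΣ₀Set : (k : ℕ) → Pred (Pt (suc k)) 0ℓ → Set
IsΣ₀Set k τ =
  (τ ⊆ InCube) × InFacet τ ×
  (∃[ a ] ((a Data.Nat.< k) ×
     ((∀ {y} → τ y → (Σ₀ y ≡ (+ 0 , + a)) ⊎ (Σ₀ y ≡ (+ 0 , + suc a)) ⊎ (Σ₀ y ≡ (+ 1 , + suc a)))
      ⊎ (∀ {y} → τ y → (Σ₀ y ≡ (+ 0 , + a)) ⊎ (Σ₀ y ≡ (+ 1 , + a)) ⊎ (Σ₀ y ≡ (+ 1 , + suc a))))))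

Ξ : (k : ℕ) → ℤ → Pred (Pt (suc k)) 0ℓ
Ξ k s y =
    (y zero ≡ - (+ 1) × InCube (tail y) × sumℤ (tail y) < s)
  ⊎ (y zero ≡ + 0     × InCube (tail y) × sumℤ (tail y) < + k)
  ⊎ (y zero ≡ + 1     × InCube (tail y) × sumℤ (tail y) > s)

shift : ∀ {n} → Pt n → Pred (Pt n) 0ℓ → Pred (Pt n) 0ℓ
shift x A y = A (λ i → y i - x i)

-- Inside the region where the last k coordinates form a cube point, Ξ^k_s is the Σ₀-preimage of
-- the planar set Ξ₂ = {-1} × (< s) ∪ {0} × (< k) ∪ {1} × (> s).  Translating by c·e₀ moves a
-- Σ₀-image horizontally by c, and on a facet xᵢ = l (i ≥ 1) translating by ±eᵢ keeps the tail in
-- the cube while moving the coordinate sum by ∓1.  A Σ₀-triangle lies in a staircase with pivot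
-- p ∈ {a, a+1}; it fits into Ξ₂ after a horizontal shift when p < s or s < p < k, and the two
-- remaining pivots p = s and p = k are moved out of the way by the facet translation (or, for
-- p = k on a facet xᵢ = 0, are excluded by it).  On a facet x₀ = l the image is a single column
-- of height two, which fits into layer 0 or, because s ≤ k - 2, into layer 1.
module Submission where

open import Defs
open import Data.Nat using (ℕ)
open import Data.Integer using (ℤ; +_; _-_; _≤_)
open import Data.Product using (∃-syntax)
open import Relation.Unary using (_⊆_)

open import Data.Nat as ℕ using (zero; suc; z≤n)
open import Data.Nat.Properties using (m≤n⇒m<n∨m≡n; n≤1+n; <⇒≤)
open import Data.Integer using (0ℤ; 1ℤ; -1ℤ; -_; _+_; _<_; _>_; +≤+; +<+) renaming (suc to sucℤ)
open import Data.Integer.Properties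
  using (+-comm; +-assoc; +-identityˡ; +-identityʳ; +-inverseʳ; +-monoˡ-≤; +-mono-≤; +-mono-<-≤; +-mono-≤-<;
         ≤-refl; ≤-reflexive; ≤-trans; ≤-<-trans; <-≤-trans; <-trans; <-cmp; ≤⇒≯;
         suc[i]≤j⇒i<j; i<j⇒suc[i]≤j; i≤pred[j]⇒i<j)
open import Data.Fin using (Fin; zero; suc)
open import Data.Vec.Functional using (_∷_; replicate; updateAt)
open import Data.Product using (_×_; _,_; map₂)
open import Data.Sum using (_⊎_; inj₁; inj₂)
open import Data.Empty using (⊥-elim)
open import Function using (_∘_; const)
open import Relation.Binary.Definitions using (tri<; tri≈; tri>)
open import Relation.Binary.PropositionalEquality using (_≡_; refl; sym; trans; cong; subst; module ≡-Reasoning)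
open import Relation.Unary using (_∩_)
open import Data.Integer.Solver using (module +-*-Solver)

i<i+1 : ∀ i → i < i + + 1
i<i+1 i = suc[i]≤j⇒i<j (≤-reflexive (+-comm 1ℤ i))

i-1<i : ∀ i → i - + 1 < i
i-1<i i = i≤pred[j]⇒i<j (≤-reflexive (+-comm i -1ℤ))

module _ {i : ℤ} (j : ℤ) (i≤j-2 : i ≤ j - + 2) where

  i≤j-2⇒i<j-1 : i < j - + 1
  i≤j-2⇒i<j-1 = ≤-<-trans i≤j-2 (subst (_< j - + 1) (+-assoc j (- + 1) (- + 1)) (i-1<i (j - + 1)))

  i≤j-2⇒i<j : i < j
  i≤j-2⇒i<j = <-trans i≤j-2⇒i<j-1 (i-1<i j)

  i≤j-2⇒i+1<j : i + + 1 < j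
  i≤j-2⇒i+1<j = ≤-<-trans (+-monoˡ-≤ (+ 1) i≤j-2) (subst (_< j) (sym (+-assoc j (- + 2) (+ 1))) (i-1<i j))

Bit : ℤ → Set
Bit z = (z ≡ + 0) ⊎ (z ≡ + 1)

Bit-−0 : ∀ {z} → Bit z → Bit (z - 0ℤ)
Bit-−0 {z} = subst Bit (sym (+-identityʳ z))

infixl 6 _−ᵥ_
infix 7 _·e_

_−ᵥ_ : ∀ {n} → Pt n → Pt n → Pt n
(u −ᵥ w) i = u i - w i

_·e_ : ∀ {n} → ℤ → Fin n → Pt n
d ·e i = updateAt (replicate _ 0ℤ) i (const d)

sumℤ-0 : ∀ n → sumℤ (replicate n 0ℤ) ≡ 0ℤ
sumℤ-0 zero    = refl
sumℤ-0 (suc n) = trans (+-identityˡ _) (sumℤ-0 n)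

sumℤ-·e : ∀ {n} d (i : Fin n) → sumℤ (d ·e i) ≡ d
sumℤ-·e {suc n} d zero    = trans (cong (_+_ d) (sumℤ-0 n)) (+-identityʳ d)
sumℤ-·e {suc n} d (suc i) = trans (+-identityˡ _) (sumℤ-·e d i)

sumℤ-−ᵥ : ∀ {n} (u w : Pt n) → sumℤ (u −ᵥ w) ≡ sumℤ u - sumℤ w
sumℤ-−ᵥ {zero}  u w = refl
sumℤ-−ᵥ {suc n} u w = begin
  (u zero - w zero) + sumℤ (tail u −ᵥ tail w)      ≡⟨ cong (_+_ (u zero - w zero)) (sumℤ-−ᵥ (tail u) (tail w)) ⟩
  (u zero - w zero) + (sumℤ (tail u) - sumℤ (tail w)) ≡⟨ interchange (u zero) (w zero) (sumℤ (tail u)) (sumℤ (tail w)) ⟩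
  (u zero + sumℤ (tail u)) - (w zero + sumℤ (tail w)) ∎
  where
  open ≡-Reasoning
  open +-*-Solver
  interchange : ∀ a b c d → (a - b) + (c - d) ≡ (a + c) - (b + d)
  interchange = solve 4 (λ a b c d → (a :- b) :+ (c :- d) := (a :+ c) :- (b :+ d)) refl

InCube-−ᵥ0 : ∀ {n} {u : Pt n} → InCube u → InCube (u −ᵥ replicate n 0ℤ)
InCube-−ᵥ0 u∈ j = Bit-−0 (u∈ j)

InCube-−ᵥ·e : ∀ {n} {u : Pt n} {d} (i : Fin n) → InCube u → Bit (u i - d) → InCube (u −ᵥ d ·e i)
InCube-−ᵥ·e zero    u∈ ui-d zero    = ui-d
InCube-−ᵥ·e zero    u∈ ui-d (suc j) = Bit-−0 (u∈ (suc j))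
InCube-−ᵥ·e (suc i) u∈ ui-d zero    = Bit-−0 (u∈ zero)
InCube-−ᵥ·e (suc i) u∈ ui-d (suc j) = InCube-−ᵥ·e i (u∈ ∘ suc) ui-d j

Bit⇒≤1 : ∀ {z} → Bit z → z ≤ + 1
Bit⇒≤1 (inj₁ refl) = +≤+ z≤n
Bit⇒≤1 (inj₂ refl) = ≤-refl

sumℤ≤dim : ∀ {n} {u : Pt n} → InCube u → sumℤ u ≤ + n
sumℤ≤dim {zero}  u∈ = +≤+ z≤n
sumℤ≤dim {suc n} u∈ = +-mono-≤ (Bit⇒≤1 (u∈ zero)) (sumℤ≤dim (u∈ ∘ suc))

sumℤ<dim : ∀ {n} {u : Pt n} (i : Fin n) → InCube u → u i ≡ 0ℤ → sumℤ u < + n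
sumℤ<dim zero    u∈ u0≡0 = +-mono-<-≤ (≤-<-trans (≤-reflexive u0≡0) (+<+ ℕ.z<s)) (sumℤ≤dim (u∈ ∘ suc))
sumℤ<dim (suc i) u∈ ui≡0 = +-mono-≤-< (Bit⇒≤1 (u∈ zero)) (sumℤ<dim i (u∈ ∘ suc) ui≡0)

Facet : ∀ {n} → Fin n → ℤ → Pt n → Set
Facet i l y = y i ≡ l

Ξ₂ : ℕ → ℤ → ℤ × ℤ → Set
Ξ₂ k s (v , b) = (v ≡ - (+ 1) × b < s) ⊎ (v ≡ + 0 × b < + k) ⊎ (v ≡ + 1 × b > s)

Ξ-intro : ∀ {k s} {y : Pt (suc k)} → InCube (tail y) → Ξ₂ k s (Σ₀ y) → Ξ k s y
Ξ-intro t∈ (inj₁ (v≡ , b<))        = inj₁ (v≡ , t∈ , b<)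
Ξ-intro t∈ (inj₂ (inj₁ (v≡ , b<))) = inj₂ (inj₁ (v≡ , t∈ , b<))
Ξ-intro t∈ (inj₂ (inj₂ (v≡ , b>))) = inj₂ (inj₂ (v≡ , t∈ , b>))

∈shiftΞ : ∀ {k s S} {y : Pt (suc k)} (c : ℤ) (t : Pt k) → InCube (tail y −ᵥ t) → sumℤ (tail y −ᵥ t) ≡ S →
          Ξ₂ k s (y zero - c , S) → shift (c ∷ t) (Ξ k s) y
∈shiftΞ {y = y} c t t∈ refl = Ξ-intro {y = y −ᵥ (c ∷ t)} t∈

∈shiftΞ₀ : ∀ {k s} {y : Pt (suc k)} (c : ℤ) → InCube y → Ξ₂ k s (y zero - c , sumℤ (tail y)) →
           shift (c ∷ replicate k 0ℤ) (Ξ k s) y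
∈shiftΞ₀ {k} {y = y} c y∈ = ∈shiftΞ {y = y} c (replicate k 0ℤ) (InCube-−ᵥ0 (y∈ ∘ suc)) (begin
  sumℤ (tail y −ᵥ replicate k 0ℤ)       ≡⟨ sumℤ-−ᵥ (tail y) (replicate k 0ℤ) ⟩
  sumℤ (tail y) - sumℤ (replicate k 0ℤ) ≡⟨ cong (_-_ (sumℤ (tail y))) (sumℤ-0 k) ⟩
  sumℤ (tail y) - 0ℤ                    ≡⟨ +-identityʳ (sumℤ (tail y)) ⟩
  sumℤ (tail y)                         ∎)
  where open ≡-Reasoning

∈shiftΞ·e : ∀ {k s l d} {y : Pt (suc k)} (c : ℤ) (i : Fin k) → InCube y → Facet (suc i) l y → Bit (l - d) →
            Ξ₂ k s (y zero - c , sumℤ (tail y) - d) → shift (c ∷ d ·e i) (Ξ k s) y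
∈shiftΞ·e {d = d} {y} c i y∈ refl l-d = ∈shiftΞ {y = y} c (d ·e i) (InCube-−ᵥ·e i (y∈ ∘ suc) l-d)
  (trans (sumℤ-−ᵥ (tail y) (d ·e i)) (cong (_-_ (sumℤ (tail y))) (sumℤ-·e d i)))

Stair : ℤ → ℤ × ℤ → Set
Stair p (v , b) = (v ≡ + 0 × b ≤ p) ⊎ (v ≡ + 1 × p ≤ b × b ≤ sucℤ p)

Stair-translate : ∀ {p v b} δ → Stair p (v , b) → Stair (p - δ) (v , b - δ)
Stair-translate δ (inj₁ (v≡ , b≤p))         = inj₁ (v≡ , +-monoˡ-≤ (- δ) b≤p)
Stair-translate {p} δ (inj₂ (v≡ , p≤b , b≤)) =
  inj₂ (v≡ , +-monoˡ-≤ (- δ) p≤b , ≤-trans (+-monoˡ-≤ (- δ) b≤) (≤-reflexive (+-assoc 1ℤ p (- δ))))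

Stair⇒Ξ₂-below : ∀ {k s p v b} → s < + k → p < s → Stair p (v , b) → Ξ₂ k s (v - + 1 , b)
Stair⇒Ξ₂-below s<k p<s (inj₁ (refl , b≤p))     = inj₁ (refl , ≤-<-trans b≤p p<s)
Stair⇒Ξ₂-below s<k p<s (inj₂ (refl , _ , b≤)) = inj₂ (inj₁ (refl , ≤-<-trans (≤-trans b≤ (i<j⇒suc[i]≤j p<s)) s<k))

Stair⇒Ξ₂-between : ∀ {k s p v b} → s < p → p < + k → Stair p (v , b) → Ξ₂ k s (v - 0ℤ , b)
Stair⇒Ξ₂-between s<p p<k (inj₁ (refl , b≤p))     = inj₂ (inj₁ (refl , ≤-<-trans b≤p p<k))
Stair⇒Ξ₂-between s<p p<k (inj₂ (refl , p≤b , _)) = inj₂ (inj₂ (refl , <-≤-trans s<p p≤b))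

Stair⇒Ξ₂-top : ∀ {k s v b} → Stair (+ k) (v , b) → b < + k → Ξ₂ k s (v - 0ℤ , b)
Stair⇒Ξ₂-top (inj₁ (refl , _))       b<k = inj₂ (inj₁ (refl , b<k))
Stair⇒Ξ₂-top (inj₂ (refl , k≤b , _)) b<k = ⊥-elim (≤⇒≯ k≤b b<k)

Band : ℕ → ℤ → Set
Band a b = + a ≤ b × b ≤ + suc a

Band⇒Ξ₂ : ∀ {k s a} → s ≤ + k - + 2 → a ℕ.< k → (l : ℤ) → ∃[ c ] (∀ {b} → Band a b → Ξ₂ k s (l - c , b))
Band⇒Ξ₂ {k} s≤k-2 a<k l with m≤n⇒m<n∨m≡n a<k
... | inj₁ 1+a<k = l , λ (_ , b≤) → inj₂ (inj₁ (+-inverseʳ l , ≤-<-trans b≤ (+<+ 1+a<k)))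
... | inj₂ refl  = l - + 1 , λ (a≤b , _) → inj₂ (inj₂ (l-[l-1]≡1 l , <-≤-trans (i≤j-2⇒i<j-1 (+ k) s≤k-2) a≤b))
  where
  open +-*-Solver
  l-[l-1]≡1 : ∀ l → l - (l - + 1) ≡ + 1
  l-[l-1]≡1 = solve 1 (λ l → l :- (l :- con (+ 1)) := con (+ 1)) refl

Triangle₁ Triangle₂ : ℕ → ℤ × ℤ → Set
Triangle₁ a q = (q ≡ (+ 0 , + a)) ⊎ (q ≡ (+ 0 , + suc a)) ⊎ (q ≡ (+ 1 , + suc a))
Triangle₂ a q = (q ≡ (+ 0 , + a)) ⊎ (q ≡ (+ 1 , + a)) ⊎ (q ≡ (+ 1 , + suc a))

Triangle₁⇒Stair : ∀ {a q} → Triangle₁ a q → Stair (+ suc a) q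
Triangle₁⇒Stair {a} (inj₁ refl)        = inj₁ (refl , +≤+ (n≤1+n a))
Triangle₁⇒Stair     (inj₂ (inj₁ refl)) = inj₁ (refl , ≤-refl)
Triangle₁⇒Stair {a} (inj₂ (inj₂ refl)) = inj₂ (refl , ≤-refl , +≤+ (n≤1+n (suc a)))

Triangle₂⇒Stair : ∀ {a q} → Triangle₂ a q → Stair (+ a) q
Triangle₂⇒Stair     (inj₁ refl)        = inj₁ (refl , ≤-refl)
Triangle₂⇒Stair {a} (inj₂ (inj₁ refl)) = inj₂ (refl , ≤-refl , +≤+ (n≤1+n a))
Triangle₂⇒Stair     (inj₂ (inj₂ refl)) = inj₂ (refl , +≤+ (n≤1+n _) , ≤-refl)

Triangle₁⇒Band : ∀ {a v b} → Triangle₁ a (v , b) → Band a b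
Triangle₁⇒Band {a} (inj₁ refl)        = ≤-refl , +≤+ (n≤1+n a)
Triangle₁⇒Band {a} (inj₂ (inj₁ refl)) = +≤+ (n≤1+n a) , ≤-refl
Triangle₁⇒Band {a} (inj₂ (inj₂ refl)) = +≤+ (n≤1+n a) , ≤-refl

Triangle₂⇒Band : ∀ {a v b} → Triangle₂ a (v , b) → Band a b
Triangle₂⇒Band {a} (inj₁ refl)        = ≤-refl , +≤+ (n≤1+n a)
Triangle₂⇒Band {a} (inj₂ (inj₁ refl)) = ≤-refl , +≤+ (n≤1+n a)
Triangle₂⇒Band {a} (inj₂ (inj₂ refl)) = +≤+ (n≤1+n a) , ≤-refl

headFacet∩Band⊆shiftΞ : ∀ {k s a} → s ≤ + k - + 2 → a ℕ.< k → (l : ℤ) →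
  ∃[ x ] (InCube ∩ Facet zero l ∩ (Band a ∘ sumℤ ∘ tail) ⊆ shift x (Ξ k s))
headFacet∩Band⊆shiftΞ {k} s≤k-2 a<k l with Band⇒Ξ₂ s≤k-2 a<k l
... | c , band⇒Ξ₂ = c ∷ replicate k 0ℤ , λ { (y∈ , refl , band) → ∈shiftΞ₀ c y∈ (band⇒Ξ₂ band) }

tailFacet∩Stair[s]⊆shiftΞ : ∀ {k s l} → s ≤ + k - + 2 → Bit l → (i : Fin k) →
  ∃[ x ] (InCube ∩ Facet (suc i) l ∩ (Stair s ∘ Σ₀) ⊆ shift x (Ξ k s))
tailFacet∩Stair[s]⊆shiftΞ {k} {s} s≤k-2 (inj₁ refl) i = 0ℤ ∷ -1ℤ ·e i , λ (y∈ , yi≡0 , st) →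
  ∈shiftΞ·e 0ℤ i y∈ yi≡0 (inj₂ refl)
    (Stair⇒Ξ₂-between (i<i+1 s) (i≤j-2⇒i+1<j (+ k) s≤k-2) (Stair-translate -1ℤ st))
tailFacet∩Stair[s]⊆shiftΞ {k} {s} s≤k-2 (inj₂ refl) i = 1ℤ ∷ 1ℤ ·e i , λ (y∈ , yi≡1 , st) →
  ∈shiftΞ·e 1ℤ i y∈ yi≡1 (inj₁ refl)
    (Stair⇒Ξ₂-below (i≤j-2⇒i<j (+ k) s≤k-2) (i-1<i s) (Stair-translate 1ℤ st))

tailFacet∩Stair[k]⊆shiftΞ : ∀ {k s l} → s ≤ + k - + 2 → Bit l → (i : Fin k) →
  ∃[ x ] (InCube ∩ Facet (suc i) l ∩ (Stair (+ k) ∘ Σ₀) ⊆ shift x (Ξ k s))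
tailFacet∩Stair[k]⊆shiftΞ {k} s≤k-2 (inj₁ refl) i = 0ℤ ∷ replicate k 0ℤ , λ (y∈ , yi≡0 , st) →
  ∈shiftΞ₀ 0ℤ y∈ (Stair⇒Ξ₂-top st (sumℤ<dim i (y∈ ∘ suc) yi≡0))
tailFacet∩Stair[k]⊆shiftΞ {k} s≤k-2 (inj₂ refl) i = 0ℤ ∷ 1ℤ ·e i , λ (y∈ , yi≡1 , st) →
  ∈shiftΞ·e 0ℤ i y∈ yi≡1 (inj₁ refl)
    (Stair⇒Ξ₂-between (i≤j-2⇒i<j-1 (+ k) s≤k-2) (i-1<i (+ k)) (Stair-translate 1ℤ st))

tailFacet∩Stair⊆shiftΞ : ∀ {k s d l} → s ≤ + k - + 2 → d ≤ + k → Bit l → (i : Fin k) →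
  ∃[ x ] (InCube ∩ Facet (suc i) l ∩ (Stair d ∘ Σ₀) ⊆ shift x (Ξ k s))
tailFacet∩Stair⊆shiftΞ {k} {s} {d} s≤k-2 d≤k l∈ i with <-cmp s d
... | tri> _ _ d<s = 1ℤ ∷ replicate k 0ℤ , λ (y∈ , _ , st) →
  ∈shiftΞ₀ 1ℤ y∈ (Stair⇒Ξ₂-below (i≤j-2⇒i<j (+ k) s≤k-2) d<s st)
... | tri≈ _ refl _ = tailFacet∩Stair[s]⊆shiftΞ s≤k-2 l∈ i
... | tri< s<d _ _ with <-cmp d (+ k)
...   | tri< d<k _ _ = 0ℤ ∷ replicate k 0ℤ , λ (y∈ , _ , st) → ∈shiftΞ₀ 0ℤ y∈ (Stair⇒Ξ₂-between s<d d<k st)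
...   | tri≈ _ refl _ = tailFacet∩Stair[k]⊆shiftΞ s≤k-2 l∈ i
...   | tri> _ _ k<d = ⊥-elim (≤⇒≯ d≤k k<d)

lemma2p2 : (k : ℕ) (s : ℤ) → s ≤ + k - + 2 →
    ∀ τ → IsΣ₀Set k τ → ∃[ x ] (τ ⊆ shift x (Ξ k s))
lemma2p2 k s s≤k-2 τ (τ⊆cube , (zero , l , _ , τ⊆facet) , (a , a<k , triangle)) =
  map₂ (λ ⊆shift τy → ⊆shift (τ⊆cube τy , τ⊆facet τy , band triangle τy)) (headFacet∩Band⊆shiftΞ s≤k-2 a<k l)
  where
  band : (τ ⊆ Triangle₁ a ∘ Σ₀) ⊎ (τ ⊆ Triangle₂ a ∘ Σ₀) → τ ⊆ Band a ∘ sumℤ ∘ tail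
  band (inj₁ ⊆T₁) = Triangle₁⇒Band ∘ ⊆T₁
  band (inj₂ ⊆T₂) = Triangle₂⇒Band ∘ ⊆T₂
lemma2p2 k s s≤k-2 τ (τ⊆cube , (suc i , l , l∈ , τ⊆facet) , (a , a<k , inj₁ ⊆T₁)) =
  map₂ (λ ⊆shift τy → ⊆shift (τ⊆cube τy , τ⊆facet τy , Triangle₁⇒Stair (⊆T₁ τy)))
       (tailFacet∩Stair⊆shiftΞ s≤k-2 (+≤+ a<k) l∈ i)
lemma2p2 k s s≤k-2 τ (τ⊆cube , (suc i , l , l∈ , τ⊆facet) , (a , a<k , inj₂ ⊆T₂)) =
  map₂ (λ ⊆shift τy → ⊆shift (τ⊆cube τy , τ⊆facet τy , Triangle₂⇒Stair (⊆T₂ τy)))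
       (tailFacet∩Stair⊆shiftΞ s≤k-2 (+≤+ (<⇒≤ a<k)) l∈ i)
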